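{- (i) The inner deterministic multirelations, with Peleg composition, identities $1_X$ and, on each homset, the complete lattice given by set inclusion with arbitrary unions $\bigcup$, form a quantaloid isomorphic to the quantaloid of binary relations ($\mathbf{Rel}$ with relational composition and inclusion/unions). (ii) The outer deterministic multirelations, with Peleg composition, identities $1_X$ and, on each homset, the complete lattice whose sups are the arbitrary inner unions $\underset{i\in I}{\Cup} S_i$ (with order $R \le S \Leftrightarrow R \Cup S = S$), form a quantaloid isomorphic to the quantaloid of binary relations.
   Context: A relation $R : X \leftrightarrow Y$ is a subset of $X \times Y$; a multirelation $R : X \leftrightarrow \mathcal{P} Y$ is a subset of $X \times \mathcal{P} Y$. $R$ is outer deterministic if it is the graph of a function $X \to \mathcal{P} Y$; inner deterministic if $B$ is a singleton whenever $(a,B) \in R$. $1_X = \{(a,\{a\}) \mid a \in X\}$. Peleg composition of $R : X \leftrightarrow \mathcal{P} Y$, $S : Y \leftrightarrow \mathcal{P} Z$: $R \ast S = \{(a,C) \mid \exists B.\ (a,B) \in R \wedge \exists f : Y \to \mathcal{P} Z.\ (\forall b \in B.\ (b,f(b)) \in S) \wedge C = \bigcup_{b \in B} f(b)\}$. Inner union of a family: $\underset{i\in I}{\Cup} R_i = \{(a,\bigcup_{i\in I} A_i) \mid \forall i \in I.\ (a,A_i) \in R_i\}$; binary inner union $R \Cup S = \{(a, A\cup B) \mid (a,A)\in R, (a,B) \in S\}$. A quantaloid is a category in which each homset is a complete lattice and composition preserves arbitrary sups in both arguments. -}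

module Defs where

open import Level using (Level; _⊔_; 0ℓ; Lift) renaming (suc to lsuc)
open import Data.Product using (Σ; _×_; _,_; ∃)
open import Data.Unit.Polymorphic using (⊤)
open import Function.Bundles using (_⇔_)
open import Relation.Unary using (Pred; _∈_; _≐_; ｛_｝; _∪_)
open import Relation.Binary.PropositionalEquality using (_≡_)

𝒫 : Set → Set₁
𝒫 Y = Pred Y 0ℓ

BRel : (ℓ : Level) → Set → Set → Set (lsuc ℓ)
BRel ℓ X Y = X → Y → Set ℓ

-- multirelations X ↔ 𝒫 Y  (membership (a , B) ∈ R is  R a B)
MRel : Set → Set → Set₂
MRel X Y = X → 𝒫 Y → Set₁

⋃⟨_⟩ : {Y Z : Set} → 𝒫 Y → (Y → 𝒫 Z) → 𝒫 Z
⋃⟨ B ⟩ f = λ z → ∃ λ b → b ∈ B × z ∈ f b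

⋃ᵢ : {Y : Set} (I : Set) → (I → 𝒫 Y) → 𝒫 Y
⋃ᵢ I A = λ y → Σ I λ i → A i y

-- a multirelation is a subset of X × 𝒫 Y, hence extensional in its
-- second component (it cannot distinguish extensionally equal subsets)
Ext : {X Y : Set} → MRel X Y → Set₁
Ext {X} R = ∀ (a : X) {B C} → B ≐ C → R a B → R a C

InnerDet : {X Y : Set} → MRel X Y → Set₁
InnerDet {X} {Y} R = ∀ (a : X) (B : 𝒫 Y) → R a B → Σ Y λ b → B ≐ ｛ b ｝

OuterDet : {X Y : Set} → MRel X Y → Set₁
OuterDet {X} {Y} R = Σ (X → 𝒫 Y) λ F → ∀ (a : X) (B : 𝒫 Y) → R a B ⇔ (B ≐ F a)

𝟙 : {X : Set} → MRel X X
𝟙 a B = Lift _ (B ≐ ｛ a ｝)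

_∗_ : {X Y Z : Set} → MRel X Y → MRel Y Z → MRel X Z
_∗_ {X} {Y} {Z} R S a C =
  Σ (𝒫 Y) λ B → R a B × Σ (Y → 𝒫 Z) λ f →
    (∀ b → b ∈ B → S b (f b)) × (C ≐ ⋃⟨ B ⟩ f)

_⊆ₘ_ : {X Y : Set} → MRel X Y → MRel X Y → Set₁
R ⊆ₘ S = ∀ a B → R a B → S a B

_≈ₘ_ : {X Y : Set} → MRel X Y → MRel X Y → Set₁
R ≈ₘ S = ∀ a B → R a B ⇔ S a B

⋃ₘ : {X Y : Set} {I : Set} → (I → MRel X Y) → MRel X Y
⋃ₘ {I = I} Rs a B = Σ I λ i → Rs i a B

⋒ : {X Y : Set} {I : Set} → (I → MRel X Y) → MRel X Y
⋒ {Y = Y} {I = I} Rs a A =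
  Σ (I → 𝒫 Y) λ As → (∀ i → Rs i a (As i)) × (A ≐ ⋃ᵢ I As)

_⋓_ : {X Y : Set} → MRel X Y → MRel X Y → MRel X Y
_⋓_ {Y = Y} R S a C =
  Σ (𝒫 Y) λ A → Σ (𝒫 Y) λ B → R a A × S a B × (C ≐ A ∪ B)

_≤ₒ_ : {X Y : Set} → MRel X Y → MRel X Y → Set₁
R ≤ₒ S = (R ⋓ S) ≈ₘ S

_⨾_ : ∀ {ℓ} {X Y Z : Set} → BRel ℓ X Y → BRel ℓ Y Z → BRel ℓ X Z
(R ⨾ S) a c = ∃ λ b → R a b × S b c

idR : ∀ {ℓ} {X : Set} → BRel ℓ X X
idR a b = Lift _ (a ≡ b)

_⊆ᵣ_ : ∀ {ℓ} {X Y : Set} → BRel ℓ X Y → BRel ℓ X Y → Set ℓ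
R ⊆ᵣ S = ∀ a b → R a b → S a b

_≈ᵣ_ : ∀ {ℓ} {X Y : Set} → BRel ℓ X Y → BRel ℓ X Y → Set ℓ
R ≈ᵣ S = ∀ a b → R a b ⇔ S a b

⋃ᵣ : ∀ {ℓ} {X Y : Set} {I : Set} → (I → BRel ℓ X Y) → BRel ℓ X Y
⋃ᵣ {I = I} Rs a b = Σ I λ i → Rs i a b

-- Quantaloid data on the objects Set: a hom-type, a predicate carving out
-- the homs of the (sub)structure, equality, order, composition (diagrammatic,
-- R ∘ S = "first R then S"), identities and sups of Set-indexed families.

record QData (h p e o : Level) : Set (lsuc (h ⊔ p ⊔ e ⊔ o)) where
  field
    Hom  : Set → Set → Set h
    P    : ∀ {X Y} → Hom X Y → Set p
    _≈_  : ∀ {X Y} → Hom X Y → Hom X Y → Set e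
    _≤_  : ∀ {X Y} → Hom X Y → Hom X Y → Set o
    _∘_  : ∀ {X Y Z} → Hom X Y → Hom Y Z → Hom X Z
    id   : ∀ {X} → Hom X X
    ⋁    : ∀ {X Y} {I : Set} → (I → Hom X Y) → Hom X Y

record IsQuantaloid {h p e o} (Q : QData h p e o) : Set (lsuc 0ℓ ⊔ h ⊔ p ⊔ e ⊔ o) where
  open QData Q
  field
    ∘-closed  : ∀ {X Y Z} {R : Hom X Y} {S : Hom Y Z} → P R → P S → P (R ∘ S)
    id-closed : ∀ {X} → P (id {X})
    ⋁-closed  : ∀ {X Y} {I : Set} {Rs : I → Hom X Y} → (∀ i → P (Rs i)) → P (⋁ Rs)
    ≈-refl  : ∀ {X Y} {R : Hom X Y} → P R → R ≈ R
    ≈-sym   : ∀ {X Y} {R S : Hom X Y} → P R → P S → R ≈ S → S ≈ R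
    ≈-trans : ∀ {X Y} {R S T : Hom X Y} → P R → P S → P T → R ≈ S → S ≈ T → R ≈ T
    ∘-cong  : ∀ {X Y Z} {R R′ : Hom X Y} {S S′ : Hom Y Z} →
              P R → P R′ → P S → P S′ → R ≈ R′ → S ≈ S′ → (R ∘ S) ≈ (R′ ∘ S′)
    identityˡ : ∀ {X Y} {R : Hom X Y} → P R → (id ∘ R) ≈ R
    identityʳ : ∀ {X Y} {R : Hom X Y} → P R → (R ∘ id) ≈ R
    assoc     : ∀ {W X Y Z} {R : Hom W X} {S : Hom X Y} {T : Hom Y Z} →
                P R → P S → P T → ((R ∘ S) ∘ T) ≈ (R ∘ (S ∘ T))
    ≤-resp-≈ : ∀ {X Y} {R R′ S S′ : Hom X Y} → P R → P R′ → P S → P S′ →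
               R ≈ R′ → S ≈ S′ → R ≤ S → R′ ≤ S′
    ≤-refl    : ∀ {X Y} {R : Hom X Y} → P R → R ≤ R
    ≤-trans   : ∀ {X Y} {R S T : Hom X Y} → P R → P S → P T → R ≤ S → S ≤ T → R ≤ T
    ≤-antisym : ∀ {X Y} {R S : Hom X Y} → P R → P S → R ≤ S → S ≤ R → R ≈ S
    ⋁-upper : ∀ {X Y} {I : Set} {Rs : I → Hom X Y} → (∀ i → P (Rs i)) →
              ∀ i → Rs i ≤ ⋁ Rs
    ⋁-least : ∀ {X Y} {I : Set} {Rs : I → Hom X Y} {S : Hom X Y} →
              (∀ i → P (Rs i)) → P S → (∀ i → Rs i ≤ S) → ⋁ Rs ≤ S
    ∘-distribˡ-⋁ : ∀ {X Y Z} {I : Set} {R : Hom X Y} {Ss : I → Hom Y Z} →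
                   P R → (∀ i → P (Ss i)) → (R ∘ ⋁ Ss) ≈ ⋁ (λ i → R ∘ Ss i)
    ∘-distribʳ-⋁ : ∀ {X Y Z} {I : Set} {Rs : I → Hom X Y} {S : Hom Y Z} →
                   (∀ i → P (Rs i)) → P S → (⋁ Rs ∘ S) ≈ ⋁ (λ i → Rs i ∘ S)

-- The functor
-- acts on the homs of Q₁ (those satisfying P₁) and may inspect the evidence
-- P₁ R; F-cong makes its result independent of that evidence up to ≈.
record IsQIso {h₁ p₁ e₁ o₁ h₂ p₂ e₂ o₂}
              (Q₁ : QData h₁ p₁ e₁ o₁) (Q₂ : QData h₂ p₂ e₂ o₂)
              (F : ∀ {X Y} (R : QData.Hom Q₁ X Y) → QData.P Q₁ R → QData.Hom Q₂ X Y)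
              : Set (lsuc 0ℓ ⊔ h₁ ⊔ p₁ ⊔ e₁ ⊔ o₁ ⊔ h₂ ⊔ p₂ ⊔ e₂ ⊔ o₂) where
  module A = QData Q₁
  module B = QData Q₂
  field
    F-closed : ∀ {X Y} {R : A.Hom X Y} (p : A.P R) → B.P (F R p)
    F-cong   : ∀ {X Y} {R S : A.Hom X Y} (p : A.P R) (q : A.P S) →
               R A.≈ S → F R p B.≈ F S q
    F-∘      : ∀ {X Y Z} {R : A.Hom X Y} {S : A.Hom Y Z} (p : A.P R) (q : A.P S)
               (pq : A.P (R A.∘ S)) → F (R A.∘ S) pq B.≈ (F R p B.∘ F S q)
    F-id     : ∀ {X} (p : A.P (A.id {X})) → F A.id p B.≈ B.id
    F-⋁      : ∀ {X Y} {I : Set} {Rs : I → A.Hom X Y} (ps : ∀ i → A.P (Rs i))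
               (p : A.P (A.⋁ Rs)) → F (A.⋁ Rs) p B.≈ B.⋁ (λ i → F (Rs i) (ps i))
    F-mono   : ∀ {X Y} {R S : A.Hom X Y} (p : A.P R) (q : A.P S) →
               R A.≤ S → F R p B.≤ F S q
    F-reflect : ∀ {X Y} {R S : A.Hom X Y} (p : A.P R) (q : A.P S) →
                F R p B.≤ F S q → R A.≤ S
    F-injective  : ∀ {X Y} {R S : A.Hom X Y} (p : A.P R) (q : A.P S) →
                   F R p B.≈ F S q → R A.≈ S
    F-surjective : ∀ {X Y} (S : B.Hom X Y) → B.P S →
                   Σ (A.Hom X Y) λ R → Σ (A.P R) λ p → F R p B.≈ S

Isomorphic : ∀ {h₁ p₁ e₁ o₁ h₂ p₂ e₂ o₂} →
             QData h₁ p₁ e₁ o₁ → QData h₂ p₂ e₂ o₂ → Set _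
Isomorphic Q₁ Q₂ =
  Σ (∀ {X Y} (R : QData.Hom Q₁ X Y) → QData.P Q₁ R → QData.Hom Q₂ X Y)
    λ F → IsQIso Q₁ Q₂ F

RelQ : (ℓ : Level) → QData (lsuc ℓ) 0ℓ ℓ ℓ
RelQ ℓ = record
  { Hom = BRel ℓ ; P = λ _ → ⊤ ; _≈_ = _≈ᵣ_ ; _≤_ = _⊆ᵣ_
  ; _∘_ = _⨾_ ; id = idR ; ⋁ = ⋃ᵣ }

InnerQ : QData (lsuc (lsuc 0ℓ)) (lsuc 0ℓ) (lsuc 0ℓ) (lsuc 0ℓ)
InnerQ = record
  { Hom = MRel ; P = λ R → Ext R × InnerDet R ; _≈_ = _≈ₘ_ ; _≤_ = _⊆ₘ_
  ; _∘_ = _∗_ ; id = 𝟙 ; ⋁ = ⋃ₘ }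

OuterQ : QData (lsuc (lsuc 0ℓ)) (lsuc 0ℓ) (lsuc 0ℓ) (lsuc 0ℓ)
OuterQ = record
  { Hom = MRel ; P = OuterDet ; _≈_ = _≈ₘ_ ; _≤_ = _≤ₒ_
  ; _∘_ = _∗_ ; id = 𝟙 ; ⋁ = ⋒ }

{-# OPTIONS --safe #-}
-- An inner deterministic multirelation R is determined by the relation
-- {(a , b) | (a , {b}) ∈ R}, an outer deterministic one by the function
-- X → 𝒫 Y it is the graph of, i.e. again by a relation.  Under these
-- correspondences Peleg composition, 1_X and the (inner) unions become
-- relational composition, the identity relation and unions, and the order
-- becomes inclusion.  A bijection on homsets that preserves and reflects all
-- of this structure pulls the quantaloid laws of Rel back, so both classes
-- are quantaloids, and isomorphic to Rel.
module Submission where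

open import Defs
open import Level using (Level; _⊔_; 0ℓ; Lift; lift; lower) renaming (suc to lsuc)
open import Data.Product using (_×_; _,_; proj₁; proj₂; ∃)
open import Data.Sum using (inj₁; inj₂; [_,_]′)
open import Data.Unit.Polymorphic using (tt)
open import Function.Bundles using (_⇔_; mk⇔; Equivalence)
open import Function.Properties.Equivalence using ()
  renaming (refl to ⇔-refl; sym to ⇔-sym; trans to ⇔-trans)
open import Relation.Binary.Bundles using (PartialSetoid)
open import Relation.Binary.PropositionalEquality using (_≡_; refl; subst)
import Relation.Binary.Reasoning.PartialSetoid as PartialSetoidReasoning
open import Relation.Unary using (_∈_; _⊆_; _≐_; ｛_｝; _∪_)
open import Relation.Unary.Properties using (≐-refl; ≐-sym; ≐-trans)

open Equivalence using (to; from)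

private variable
  X Y Z : Set
  I : Set

≐⇒⇔ : {A B : 𝒫 X} → A ≐ B → ∀ x → x ∈ A ⇔ x ∈ B
≐⇒⇔ (A⊆B , B⊆A) x = mk⇔ A⊆B B⊆A

⇔⇒≐ : {A B : 𝒫 X} → (∀ x → x ∈ A ⇔ x ∈ B) → A ≐ B
⇔⇒≐ A⇔B = (λ {x} → to (A⇔B x)) , (λ {x} → from (A⇔B x))

｛｝-injective : {x y : X} → ｛ x ｝ ≐ ｛ y ｝ → y ≡ x
｛｝-injective (｛x｝⊆｛y｝ , _) = ｛x｝⊆｛y｝ refl

⋃⟨｛｝⟩ : {B : 𝒫 Y} {b : Y} {f : Y → 𝒫 Z} → B ≐ ｛ b ｝ → ⋃⟨ B ⟩ f ≐ f b
⋃⟨｛｝⟩ {B = B} {b} {f} (B⊆｛b｝ , ｛b｝⊆B) = ⋃⊆fb , λ z∈fb → b , ｛b｝⊆B refl , z∈fb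
  where
  ⋃⊆fb : ⋃⟨ B ⟩ f ⊆ f b
  ⋃⊆fb (b′ , b′∈B , z∈fb′) with B⊆｛b｝ b′∈B
  ... | refl = z∈fb′

⋃⟨⟩-cong : {B B′ : 𝒫 Y} {f g : Y → 𝒫 Z} →
           B ≐ B′ → (∀ b → b ∈ B → f b ≐ g b) → ⋃⟨ B ⟩ f ≐ ⋃⟨ B′ ⟩ g
⋃⟨⟩-cong (B⊆B′ , B′⊆B) f≐g =
    (λ (b , b∈B , z∈fb) → b , B⊆B′ b∈B , proj₁ (f≐g b b∈B) z∈fb)
  , (λ (b , b∈B′ , z∈gb) → b , B′⊆B b∈B′ , proj₂ (f≐g b (B′⊆B b∈B′)) z∈gb)

⋃ᵢ-cong : {A B : I → 𝒫 Y} → (∀ i → A i ≐ B i) → ⋃ᵢ I A ≐ ⋃ᵢ I B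
⋃ᵢ-cong A≐B = (λ (i , y∈Ai) → i , proj₁ (A≐B i) y∈Ai)
            , (λ (i , y∈Bi) → i , proj₂ (A≐B i) y∈Bi)

∪-cong : {A A′ B B′ : 𝒫 Y} → A ≐ A′ → B ≐ B′ → A ∪ B ≐ A′ ∪ B′
∪-cong (A⊆A′ , A′⊆A) (B⊆B′ , B′⊆B) =
    [ (λ x∈A → inj₁ (A⊆A′ x∈A)) , (λ x∈B → inj₂ (B⊆B′ x∈B)) ]′
  , [ (λ x∈A′ → inj₁ (A′⊆A x∈A′)) , (λ x∈B′ → inj₂ (B′⊆B x∈B′)) ]′

record ClosedUnderOperations {h p e o} (Q : QData h p e o) : Set (lsuc 0ℓ ⊔ h ⊔ p) where
  open QData Q
  field
    ∘-closed  : ∀ {X Y Z} {R : Hom X Y} {S : Hom Y Z} → P R → P S → P (R ∘ S)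
    id-closed : ∀ {X} → P (id {X})
    ⋁-closed  : ∀ {X Y} {I : Set} {Rs : I → Hom X Y} → (∀ i → P (Rs i)) → P (⋁ Rs)

module IsQuantaloidProperties {h p e o} {Q : QData h p e o} (isQ : IsQuantaloid Q) where
  open QData Q
  open IsQuantaloid isQ

  -- Unlike ≈, this is transitive without evidence of P for the middle hom,
  -- so it supports equational reasoning.
  infix 4 _≈ᴾ_
  _≈ᴾ_ : Hom X Y → Hom X Y → Set (p ⊔ e)
  R ≈ᴾ S = P R × P S × R ≈ S

  ≈ᴾ-refl : {R : Hom X Y} → P R → R ≈ᴾ R
  ≈ᴾ-refl pR = pR , pR , ≈-refl pR

  ≈ᴾ-sym : {R S : Hom X Y} → R ≈ᴾ S → S ≈ᴾ R
  ≈ᴾ-sym (pR , pS , R≈S) = pS , pR , ≈-sym pR pS R≈S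

  ≈ᴾ-trans : {R S T : Hom X Y} → R ≈ᴾ S → S ≈ᴾ T → R ≈ᴾ T
  ≈ᴾ-trans (pR , pS , R≈S) (_ , pT , S≈T) = pR , pT , ≈-trans pR pS pT R≈S S≈T

  ≈ᴾ-partialSetoid : Set → Set → PartialSetoid h (p ⊔ e)
  ≈ᴾ-partialSetoid X Y = record
    { _≈_ = _≈ᴾ_ {X} {Y}
    ; isPartialEquivalence = record { sym = ≈ᴾ-sym ; trans = ≈ᴾ-trans }
    }

  module ≈ᴾ-Reasoning {X Y : Set} = PartialSetoidReasoning (≈ᴾ-partialSetoid X Y)

  ∘-congᴾ : {R R′ : Hom X Y} {S S′ : Hom Y Z} → R ≈ᴾ R′ → S ≈ᴾ S′ → (R ∘ S) ≈ᴾ (R′ ∘ S′)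
  ∘-congᴾ (pR , pR′ , R≈R′) (pS , pS′ , S≈S′) =
    ∘-closed pR pS , ∘-closed pR′ pS′ , ∘-cong pR pR′ pS pS′ R≈R′ S≈S′

  identityˡᴾ : {R : Hom X Y} → P R → (id ∘ R) ≈ᴾ R
  identityˡᴾ pR = ∘-closed id-closed pR , pR , identityˡ pR

  identityʳᴾ : {R : Hom X Y} → P R → (R ∘ id) ≈ᴾ R
  identityʳᴾ pR = ∘-closed pR id-closed , pR , identityʳ pR

  assocᴾ : ∀ {W} {R : Hom W X} {S : Hom X Y} {T : Hom Y Z} → P R → P S → P T →
           ((R ∘ S) ∘ T) ≈ᴾ (R ∘ (S ∘ T))
  assocᴾ pR pS pT =
    ∘-closed (∘-closed pR pS) pT , ∘-closed pR (∘-closed pS pT) , assoc pR pS pT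

  ∘-distribˡ-⋁ᴾ : {R : Hom X Y} {Ss : I → Hom Y Z} → P R → (∀ i → P (Ss i)) →
                  (R ∘ ⋁ Ss) ≈ᴾ ⋁ (λ i → R ∘ Ss i)
  ∘-distribˡ-⋁ᴾ pR pSs =
    ∘-closed pR (⋁-closed pSs) , ⋁-closed (λ i → ∘-closed pR (pSs i)) , ∘-distribˡ-⋁ pR pSs

  ∘-distribʳ-⋁ᴾ : {Rs : I → Hom X Y} {S : Hom Y Z} → (∀ i → P (Rs i)) → P S →
                  (⋁ Rs ∘ S) ≈ᴾ ⋁ (λ i → Rs i ∘ S)
  ∘-distribʳ-⋁ᴾ pRs pS =
    ∘-closed (⋁-closed pRs) pS , ⋁-closed (λ i → ∘-closed (pRs i) pS) , ∘-distribʳ-⋁ pRs pS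

  ≤-respʳ-≈ᴾ : {R S S′ : Hom X Y} → P R → S ≈ᴾ S′ → R ≤ S → R ≤ S′
  ≤-respʳ-≈ᴾ pR (pS , pS′ , S≈S′) = ≤-resp-≈ pR pR pS pS′ (≈-refl pR) S≈S′

  ≤-respˡ-≈ᴾ : {R R′ S : Hom X Y} → P S → R ≈ᴾ R′ → R ≤ S → R′ ≤ S
  ≤-respˡ-≈ᴾ pS (pR , pR′ , R≈R′) = ≤-resp-≈ pR pR′ pS pS R≈R′ (≈-refl pS)

  ⋁-mono : {Rs Ss : I → Hom X Y} → (∀ i → P (Rs i)) → (∀ i → P (Ss i)) →
           (∀ i → Rs i ≤ Ss i) → ⋁ Rs ≤ ⋁ Ss
  ⋁-mono pRs pSs Rs≤Ss = ⋁-least pRs (⋁-closed pSs) λ i →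
    ≤-trans (pRs i) (pSs i) (⋁-closed pSs) (Rs≤Ss i) (⋁-upper pSs i)

  ⋁-congᴾ : {Rs Ss : I → Hom X Y} → (∀ i → Rs i ≈ᴾ Ss i) → ⋁ Rs ≈ᴾ ⋁ Ss
  ⋁-congᴾ {Rs = Rs} {Ss} Rs≈Ss = ⋁-closed pRs , ⋁-closed pSs , ≤-antisym (⋁-closed pRs) (⋁-closed pSs)
    (⋁-mono pRs pSs λ i → ≤-respʳ-≈ᴾ (pRs i) (Rs≈Ss i) (≤-refl (pRs i)))
    (⋁-mono pSs pRs λ i → ≤-respʳ-≈ᴾ (pSs i) (≈ᴾ-sym (Rs≈Ss i)) (≤-refl (pSs i)))
    where
    pRs : ∀ i → P (Rs i)
    pRs i = proj₁ (Rs≈Ss i)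
    pSs : ∀ i → P (Ss i)
    pSs i = proj₁ (proj₂ (Rs≈Ss i))

module _ {h₁ p₁ e₁ o₁ h₂ p₂ e₂ o₂} {Q₁ : QData h₁ p₁ e₁ o₁} {Q₂ : QData h₂ p₂ e₂ o₂}
         {F : ∀ {X Y} (R : QData.Hom Q₁ X Y) → QData.P Q₁ R → QData.Hom Q₂ X Y}
         (closed : ClosedUnderOperations Q₁) (iso : IsQIso Q₁ Q₂ F)
         (isQ₂ : IsQuantaloid Q₂)
         where

  private
    open ClosedUnderOperations closed
    open IsQIso iso
    module Q₂ = IsQuantaloid isQ₂
    open IsQuantaloidProperties isQ₂
    open ≈ᴾ-Reasoning

    reflect-≈ᴾ : {R S : A.Hom X Y} (p : A.P R) (q : A.P S) → F R p ≈ᴾ F S q → R A.≈ S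
    reflect-≈ᴾ p q (_ , _ , FR≈FS) = F-injective p q FR≈FS

    F-congᴾ : {R S : A.Hom X Y} (p : A.P R) (q : A.P S) → R A.≈ S → F R p ≈ᴾ F S q
    F-congᴾ p q R≈S = F-closed p , F-closed q , F-cong p q R≈S

    F-∘ᴾ : {R : A.Hom X Y} {S : A.Hom Y Z} (p : A.P R) (q : A.P S) (pq : A.P (R A.∘ S)) →
           F (R A.∘ S) pq ≈ᴾ (F R p B.∘ F S q)
    F-∘ᴾ p q pq = F-closed pq , Q₂.∘-closed (F-closed p) (F-closed q) , F-∘ p q pq

    F-idᴾ : (p : A.P (A.id {X})) → F A.id p ≈ᴾ B.id
    F-idᴾ p = F-closed p , Q₂.id-closed , F-id p

    F-⋁ᴾ : {Rs : I → A.Hom X Y} (ps : ∀ i → A.P (Rs i)) (p : A.P (A.⋁ Rs)) →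
           F (A.⋁ Rs) p ≈ᴾ B.⋁ (λ i → F (Rs i) (ps i))
    F-⋁ᴾ ps p = F-closed p , Q₂.⋁-closed (λ i → F-closed (ps i)) , F-⋁ ps p

    ∘-cong₁ : {R R′ : A.Hom X Y} {S S′ : A.Hom Y Z} → A.P R → A.P R′ → A.P S → A.P S′ →
              R A.≈ R′ → S A.≈ S′ → (R A.∘ S) A.≈ (R′ A.∘ S′)
    ∘-cong₁ {R = R} {R′} {S} {S′} p p′ q q′ R≈R′ S≈S′ =
      reflect-≈ᴾ (∘-closed p q) (∘-closed p′ q′) (begin
        F (R A.∘ S) _      ≈⟨ F-∘ᴾ p q _ ⟩
        F R p B.∘ F S q    ≈⟨ ∘-congᴾ (F-congᴾ p p′ R≈R′) (F-congᴾ q q′ S≈S′) ⟩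
        F R′ p′ B.∘ F S′ q′ ≈⟨ F-∘ᴾ p′ q′ _ ⟨
        F (R′ A.∘ S′) _    ∎)

    identityˡ₁ : {R : A.Hom X Y} (p : A.P R) → (A.id A.∘ R) A.≈ R
    identityˡ₁ {R = R} p = reflect-≈ᴾ (∘-closed id-closed p) p (begin
      F (A.id A.∘ R) _           ≈⟨ F-∘ᴾ id-closed p _ ⟩
      F A.id id-closed B.∘ F R p ≈⟨ ∘-congᴾ (F-idᴾ id-closed) (≈ᴾ-refl (F-closed p)) ⟩
      B.id B.∘ F R p             ≈⟨ identityˡᴾ (F-closed p) ⟩
      F R p                      ∎)

    identityʳ₁ : {R : A.Hom X Y} (p : A.P R) → (R A.∘ A.id) A.≈ R
    identityʳ₁ {R = R} p = reflect-≈ᴾ (∘-closed p id-closed) p (begin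
      F (R A.∘ A.id) _           ≈⟨ F-∘ᴾ p id-closed _ ⟩
      F R p B.∘ F A.id id-closed ≈⟨ ∘-congᴾ (≈ᴾ-refl (F-closed p)) (F-idᴾ id-closed) ⟩
      F R p B.∘ B.id             ≈⟨ identityʳᴾ (F-closed p) ⟩
      F R p                      ∎)

    assoc₁ : ∀ {W} {R : A.Hom W X} {S : A.Hom X Y} {T : A.Hom Y Z} →
             A.P R → A.P S → A.P T → ((R A.∘ S) A.∘ T) A.≈ (R A.∘ (S A.∘ T))
    assoc₁ {R = R} {S} {T} p q r =
      reflect-≈ᴾ (∘-closed pq r) (∘-closed p qr) (begin
        F ((R A.∘ S) A.∘ T) _         ≈⟨ F-∘ᴾ pq r _ ⟩
        F (R A.∘ S) pq B.∘ F T r      ≈⟨ ∘-congᴾ (F-∘ᴾ p q pq) (≈ᴾ-refl (F-closed r)) ⟩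
        (F R p B.∘ F S q) B.∘ F T r   ≈⟨ assocᴾ (F-closed p) (F-closed q) (F-closed r) ⟩
        F R p B.∘ (F S q B.∘ F T r)   ≈⟨ ∘-congᴾ (≈ᴾ-refl (F-closed p)) (F-∘ᴾ q r qr) ⟨
        F R p B.∘ F (S A.∘ T) qr      ≈⟨ F-∘ᴾ p qr _ ⟨
        F (R A.∘ (S A.∘ T)) _         ∎)
      where
      pq : A.P (R A.∘ S)
      pq = ∘-closed p q
      qr : A.P (S A.∘ T)
      qr = ∘-closed q r

    ∘-distribˡ-⋁₁ : {R : A.Hom X Y} {Ss : I → A.Hom Y Z} → A.P R → (∀ i → A.P (Ss i)) →
                    (R A.∘ A.⋁ Ss) A.≈ A.⋁ (λ i → R A.∘ Ss i)
    ∘-distribˡ-⋁₁ {R = R} {Ss} p qs =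
      reflect-≈ᴾ (∘-closed p (⋁-closed qs)) (⋁-closed pqs) (begin
        F (R A.∘ A.⋁ Ss) _                        ≈⟨ F-∘ᴾ p (⋁-closed qs) _ ⟩
        F R p B.∘ F (A.⋁ Ss) (⋁-closed qs)        ≈⟨ ∘-congᴾ (≈ᴾ-refl (F-closed p)) (F-⋁ᴾ qs _) ⟩
        F R p B.∘ B.⋁ (λ i → F (Ss i) (qs i))     ≈⟨ ∘-distribˡ-⋁ᴾ (F-closed p) (λ i → F-closed (qs i)) ⟩
        B.⋁ (λ i → F R p B.∘ F (Ss i) (qs i))     ≈⟨ ⋁-congᴾ (λ i → F-∘ᴾ p (qs i) (pqs i)) ⟨
        B.⋁ (λ i → F (R A.∘ Ss i) (pqs i))        ≈⟨ F-⋁ᴾ pqs _ ⟨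
        F (A.⋁ (λ i → R A.∘ Ss i)) _              ∎)
      where
      pqs : ∀ i → A.P (R A.∘ Ss i)
      pqs i = ∘-closed p (qs i)

    ∘-distribʳ-⋁₁ : {Rs : I → A.Hom X Y} {S : A.Hom Y Z} → (∀ i → A.P (Rs i)) → A.P S →
                    (A.⋁ Rs A.∘ S) A.≈ A.⋁ (λ i → Rs i A.∘ S)
    ∘-distribʳ-⋁₁ {Rs = Rs} {S} ps q =
      reflect-≈ᴾ (∘-closed (⋁-closed ps) q) (⋁-closed psq) (begin
        F (A.⋁ Rs A.∘ S) _                        ≈⟨ F-∘ᴾ (⋁-closed ps) q _ ⟩
        F (A.⋁ Rs) (⋁-closed ps) B.∘ F S q        ≈⟨ ∘-congᴾ (F-⋁ᴾ ps _) (≈ᴾ-refl (F-closed q)) ⟩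
        B.⋁ (λ i → F (Rs i) (ps i)) B.∘ F S q     ≈⟨ ∘-distribʳ-⋁ᴾ (λ i → F-closed (ps i)) (F-closed q) ⟩
        B.⋁ (λ i → F (Rs i) (ps i) B.∘ F S q)     ≈⟨ ⋁-congᴾ (λ i → F-∘ᴾ (ps i) q (psq i)) ⟨
        B.⋁ (λ i → F (Rs i A.∘ S) (psq i))        ≈⟨ F-⋁ᴾ psq _ ⟨
        F (A.⋁ (λ i → Rs i A.∘ S)) _              ∎)
      where
      psq : ∀ i → A.P (Rs i A.∘ S)
      psq i = ∘-closed (ps i) q

  isQuantaloid-transport : IsQuantaloid Q₁
  isQuantaloid-transport = record
    { ∘-closed  = ∘-closed
    ; id-closed = id-closed
    ; ⋁-closed  = ⋁-closed
    ; ≈-refl    = λ p → reflect-≈ᴾ p p (≈ᴾ-refl (F-closed p))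
    ; ≈-sym     = λ p q R≈S → reflect-≈ᴾ q p (≈ᴾ-sym (F-congᴾ p q R≈S))
    ; ≈-trans   = λ p q r R≈S S≈T →
        reflect-≈ᴾ p r (≈ᴾ-trans (F-congᴾ p q R≈S) (F-congᴾ q r S≈T))
    ; ∘-cong    = ∘-cong₁
    ; identityˡ = identityˡ₁
    ; identityʳ = identityʳ₁
    ; assoc     = assoc₁
    ; ≤-resp-≈  = λ p p′ q q′ R≈R′ S≈S′ R≤S → F-reflect p′ q′
        (Q₂.≤-resp-≈ (F-closed p) (F-closed p′) (F-closed q) (F-closed q′)
          (F-cong p p′ R≈R′) (F-cong q q′ S≈S′) (F-mono p q R≤S))
    ; ≤-refl    = λ p → F-reflect p p (Q₂.≤-refl (F-closed p))
    ; ≤-trans   = λ p q r R≤S S≤T → F-reflect p r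
        (Q₂.≤-trans (F-closed p) (F-closed q) (F-closed r) (F-mono p q R≤S) (F-mono q r S≤T))
    ; ≤-antisym = λ p q R≤S S≤R → F-injective p q
        (Q₂.≤-antisym (F-closed p) (F-closed q) (F-mono p q R≤S) (F-mono q p S≤R))
    ; ⋁-upper   = λ ps i → F-reflect (ps i) (⋁-closed ps)
        (≤-respʳ-≈ᴾ (F-closed (ps i)) (≈ᴾ-sym (F-⋁ᴾ ps (⋁-closed ps)))
          (Q₂.⋁-upper (λ j → F-closed (ps j)) i))
    ; ⋁-least   = λ ps q Rs≤S → F-reflect (⋁-closed ps) q
        (≤-respˡ-≈ᴾ (F-closed q) (≈ᴾ-sym (F-⋁ᴾ ps (⋁-closed ps)))
          (Q₂.⋁-least (λ i → F-closed (ps i)) (F-closed q) (λ i → F-mono (ps i) q (Rs≤S i))))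
    ; ∘-distribˡ-⋁ = ∘-distribˡ-⋁₁
    ; ∘-distribʳ-⋁ = ∘-distribʳ-⋁₁
    }

Rel-isQuantaloid : (ℓ : Level) → IsQuantaloid (RelQ ℓ)
Rel-isQuantaloid ℓ = record
  { ∘-closed  = λ _ _ → tt
  ; id-closed = tt
  ; ⋁-closed  = λ _ → tt
  ; ≈-refl    = λ _ a b → ⇔-refl
  ; ≈-sym     = λ _ _ R≈S a b → ⇔-sym (R≈S a b)
  ; ≈-trans   = λ _ _ _ R≈S S≈T a b → ⇔-trans (R≈S a b) (S≈T a b)
  ; ∘-cong    = λ _ _ _ _ R≈R′ S≈S′ a c → mk⇔
      (λ (b , r , s) → b , to (R≈R′ a b) r , to (S≈S′ b c) s)
      (λ (b , r , s) → b , from (R≈R′ a b) r , from (S≈S′ b c) s)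
  ; identityˡ = λ _ a c → mk⇔ (λ { (_ , lift refl , r) → r }) (λ r → a , lift refl , r)
  ; identityʳ = λ _ a c → mk⇔ (λ { (_ , r , lift refl) → r }) (λ r → c , r , lift refl)
  ; assoc     = λ _ _ _ a d → mk⇔
      (λ (c , (b , r , s) , t) → b , r , c , s , t)
      (λ (b , r , c , s , t) → c , (b , r , s) , t)
  ; ≤-resp-≈  = λ _ _ _ _ R≈R′ S≈S′ R⊆S a b r → to (S≈S′ a b) (R⊆S a b (from (R≈R′ a b) r))
  ; ≤-refl    = λ _ a b r → r
  ; ≤-trans   = λ _ _ _ R⊆S S⊆T a b r → S⊆T a b (R⊆S a b r)
  ; ≤-antisym = λ _ _ R⊆S S⊆R a b → mk⇔ (R⊆S a b) (S⊆R a b)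
  ; ⋁-upper   = λ _ i a b r → i , r
  ; ⋁-least   = λ _ _ Rs⊆S a b (i , r) → Rs⊆S i a b r
  ; ∘-distribˡ-⋁ = λ _ _ a c → mk⇔
      (λ (b , r , i , s) → i , b , r , s)
      (λ (i , b , r , s) → b , r , i , s)
  ; ∘-distribʳ-⋁ = λ _ _ a c → mk⇔
      (λ (b , (i , r) , s) → i , b , r , s)
      (λ (i , b , r , s) → b , (i , r) , s)
  }

-- Inner deterministic multirelations

∗-ext : {R : MRel X Y} {S : MRel Y Z} → Ext (R ∗ S)
∗-ext a C≐C′ (B , r , f , s , C≐⋃) = B , r , f , s , ≐-trans (≐-sym C≐C′) C≐⋃

𝟙-ext : Ext (𝟙 {X})
𝟙-ext a B≐C (lift B≐｛a｝) = lift (≐-trans (≐-sym B≐C) B≐｛a｝)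

⋃ₘ-ext : {Rs : I → MRel X Y} → (∀ i → Ext (Rs i)) → Ext (⋃ₘ Rs)
⋃ₘ-ext exts a B≐C (i , r) = i , exts i a B≐C r

∗-innerDet : {R : MRel X Y} {S : MRel Y Z} → InnerDet R → InnerDet S → InnerDet (R ∗ S)
∗-innerDet iR iS a C (B , r , f , s , C≐⋃) with iR a B r
... | b , B≐｛b｝ with iS b (f b) (s b (proj₂ B≐｛b｝ refl))
...   | c , fb≐｛c｝ = c , ≐-trans C≐⋃ (≐-trans (⋃⟨｛｝⟩ {f = f} B≐｛b｝) fb≐｛c｝)

𝟙-innerDet : InnerDet (𝟙 {X})
𝟙-innerDet a B (lift B≐｛a｝) = a , B≐｛a｝

⋃ₘ-innerDet : {Rs : I → MRel X Y} → (∀ i → InnerDet (Rs i)) → InnerDet (⋃ₘ Rs)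
⋃ₘ-innerDet iRs a B (i , r) = iRs i a B r

innerClosed : ClosedUnderOperations InnerQ
innerClosed = record
  { ∘-closed  = λ {R = R} {S} (_ , iR) (_ , iS) → ∗-ext {R = R} {S} , ∗-innerDet iR iS
  ; id-closed = 𝟙-ext , 𝟙-innerDet
  ; ⋁-closed  = λ ps → ⋃ₘ-ext (λ i → proj₁ (ps i)) , ⋃ₘ-innerDet (λ i → proj₂ (ps i))
  }

toRel : MRel X Y → BRel (lsuc 0ℓ) X Y
toRel R a b = R a ｛ b ｝

fromRel : BRel (lsuc 0ℓ) X Y → MRel X Y
fromRel S a B = ∃ λ b → S a b × B ≐ ｛ b ｝

toRel-∗ : {R : MRel X Y} {S : MRel Y Z} → Ext R → InnerDet R → Ext S →
          toRel (R ∗ S) ≈ᵣ (toRel R ⨾ toRel S)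
toRel-∗ {R = R} {S} eR iR eS a c = mk⇔ split join
  where
  split : (R ∗ S) a ｛ c ｝ → (toRel R ⨾ toRel S) a c
  split (B , r , f , s , ｛c｝≐⋃) with iR a B r
  ... | b , B≐｛b｝ = b , eR a B≐｛b｝ r , eS b fb≐｛c｝ (s b (proj₂ B≐｛b｝ refl))
    where
    fb≐｛c｝ : f b ≐ ｛ c ｝
    fb≐｛c｝ = ≐-sym (≐-trans ｛c｝≐⋃ (⋃⟨｛｝⟩ B≐｛b｝))

  join : (toRel R ⨾ toRel S) a c → (R ∗ S) a ｛ c ｝
  join (b , r , s) = ｛ b ｝ , r , (λ _ → ｛ c ｝) , (λ { _ refl → s }) , ≐-sym (⋃⟨｛｝⟩ ≐-refl)

toRel-𝟙 : toRel (𝟙 {X}) ≈ᵣ idR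
toRel-𝟙 a b = mk⇔ (λ (lift ｛b｝≐｛a｝) → lift (｛｝-injective ｛b｝≐｛a｝))
                  (λ { (lift refl) → lift ≐-refl })

toRel-reflects-⊆ : {R S : MRel X Y} → Ext R → InnerDet R → Ext S →
                   toRel R ⊆ᵣ toRel S → R ⊆ₘ S
toRel-reflects-⊆ eR iR eS R⊆S a B r with iR a B r
... | b , B≐｛b｝ = eS a (≐-sym B≐｛b｝) (R⊆S a b (eR a B≐｛b｝ r))

fromRel-ext : {S : BRel (lsuc 0ℓ) X Y} → Ext (fromRel S)
fromRel-ext a B≐C (b , s , B≐｛b｝) = b , s , ≐-trans (≐-sym B≐C) B≐｛b｝

fromRel-innerDet : {S : BRel (lsuc 0ℓ) X Y} → InnerDet (fromRel S)
fromRel-innerDet a B (b , _ , B≐｛b｝) = b , B≐｛b｝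

toRel-fromRel : (S : BRel (lsuc 0ℓ) X Y) → toRel (fromRel S) ≈ᵣ S
toRel-fromRel S a b = mk⇔
  (λ (b′ , s , ｛b｝≐｛b′｝) → subst (S a) (｛｝-injective ｛b｝≐｛b′｝) s)
  (λ s → b , s , ≐-refl)

inner≅Rel : IsQIso InnerQ (RelQ (lsuc 0ℓ)) (λ R _ → toRel R)
inner≅Rel = record
  { F-closed     = λ _ → tt
  ; F-cong       = λ _ _ R≈S a b → R≈S a ｛ b ｝
  ; F-∘          = λ (eR , iR) (eS , _) _ → toRel-∗ eR iR eS
  ; F-id         = λ _ → toRel-𝟙
  ; F-⋁          = λ _ _ a b → ⇔-refl
  ; F-mono       = λ _ _ R⊆S a b → R⊆S a ｛ b ｝
  ; F-reflect    = λ (eR , iR) (eS , _) → toRel-reflects-⊆ eR iR eS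
  ; F-injective  = λ (eR , iR) (eS , iS) R≈S a B → mk⇔
      (toRel-reflects-⊆ eR iR eS (λ a b → to (R≈S a b)) a B)
      (toRel-reflects-⊆ eS iS eR (λ a b → from (R≈S a b)) a B)
  ; F-surjective = λ S _ → fromRel S , (fromRel-ext , fromRel-innerDet) , toRel-fromRel S
  }

-- Outer deterministic multirelations

outerFun : {R : MRel X Y} → OuterDet R → X → 𝒫 Y
outerFun = proj₁

outerFun-related : {R : MRel X Y} (p : OuterDet R) (a : X) → R a (outerFun p a)
outerFun-related (F , R⇔F) a = from (R⇔F a (F a)) ≐-refl

outerFun-determined : {R : MRel X Y} (p : OuterDet R) {a : X} {B : 𝒫 Y} →
                      R a B → B ≐ outerFun p a
outerFun-determined (F , R⇔F) {a} {B} = to (R⇔F a B)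

outerFun-≐ : {R S : MRel X Y} (p : OuterDet R) (q : OuterDet S) →
             R ≈ₘ S → ∀ a → outerFun p a ≐ outerFun q a
outerFun-≐ p q R≈S a = outerFun-determined q (to (R≈S a _) (outerFun-related p a))

outerFun-unique : {R : MRel X Y} (p q : OuterDet R) → ∀ a → outerFun p a ≐ outerFun q a
outerFun-unique p q = outerFun-≐ p q (λ a B → ⇔-refl)

≈ₘ-fromOuterFun : {R S : MRel X Y} (p : OuterDet R) (q : OuterDet S) →
                  (∀ a → outerFun p a ≐ outerFun q a) → R ≈ₘ S
≈ₘ-fromOuterFun (F , R⇔F) (G , S⇔G) F≐G a B = mk⇔
  (λ r → from (S⇔G a B) (≐-trans (to (R⇔F a B) r) (F≐G a)))
  (λ s → from (R⇔F a B) (≐-trans (to (S⇔G a B) s) (≐-sym (F≐G a))))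

graph : (X → 𝒫 Y) → MRel X Y
graph F a B = Lift (lsuc 0ℓ) (B ≐ F a)

graph-outerDet : (F : X → 𝒫 Y) → OuterDet (graph F)
graph-outerDet F = F , λ a B → mk⇔ lower lift

∗-outerDet : {R : MRel X Y} {S : MRel Y Z} → OuterDet R → OuterDet S → OuterDet (R ∗ S)
∗-outerDet p@(F , _) q@(G , _) = (λ a → ⋃⟨ F a ⟩ G) , λ a C → mk⇔
  (λ (B , r , f , s , C≐⋃) → ≐-trans C≐⋃
     (⋃⟨⟩-cong (outerFun-determined p r) λ b b∈B → outerFun-determined q (s b b∈B)))
  (λ C≐⋃ → F a , outerFun-related p a , G , (λ b _ → outerFun-related q b) , C≐⋃)

𝟙-outerDet : OuterDet (𝟙 {X})
𝟙-outerDet = graph-outerDet ｛_｝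

⋒-outerDet : {Rs : I → MRel X Y} → (∀ i → OuterDet (Rs i)) → OuterDet (⋒ Rs)
⋒-outerDet {I = I} ps = (λ a → ⋃ᵢ I (λ i → outerFun (ps i) a)) , λ a A → mk⇔
  (λ (As , rs , A≐⋃) → ≐-trans A≐⋃ (⋃ᵢ-cong λ i → outerFun-determined (ps i) (rs i)))
  (λ A≐⋃ → (λ i → outerFun (ps i) a) , (λ i → outerFun-related (ps i) a) , A≐⋃)

⋓-outerDet : {R S : MRel X Y} → OuterDet R → OuterDet S → OuterDet (R ⋓ S)
⋓-outerDet p@(F , _) q@(G , _) = (λ a → F a ∪ G a) , λ a C → mk⇔
  (λ (A , B , r , s , C≐A∪B) → ≐-trans C≐A∪B
     (∪-cong (outerFun-determined p r) (outerFun-determined q s)))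
  (λ C≐F∪G → F a , G a , outerFun-related p a , outerFun-related q a , C≐F∪G)

outerClosed : ClosedUnderOperations OuterQ
outerClosed = record
  { ∘-closed  = ∗-outerDet
  ; id-closed = 𝟙-outerDet
  ; ⋁-closed  = ⋒-outerDet
  }

≤ₒ⇒outerFun-⊆ : {R S : MRel X Y} (p : OuterDet R) (q : OuterDet S) →
                R ≤ₒ S → ∀ a → outerFun p a ⊆ outerFun q a
≤ₒ⇒outerFun-⊆ p q R⋓S≈S a x∈Fa = proj₁ (outerFun-≐ (⋓-outerDet p q) q R⋓S≈S a) (inj₁ x∈Fa)

outerFun-⊆⇒≤ₒ : {R S : MRel X Y} (p : OuterDet R) (q : OuterDet S) →
                (∀ a → outerFun p a ⊆ outerFun q a) → R ≤ₒ S
outerFun-⊆⇒≤ₒ p q F⊆G = ≈ₘ-fromOuterFun (⋓-outerDet p q) q λ a →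
  [ F⊆G a , (λ x∈Ga → x∈Ga) ]′ , inj₂

outer≅Rel : IsQIso OuterQ (RelQ 0ℓ) (λ _ → outerFun)
outer≅Rel = record
  { F-closed     = λ _ → tt
  ; F-cong       = λ p q R≈S a → ≐⇒⇔ (outerFun-≐ p q R≈S a)
  ; F-∘          = λ p q pq a → ≐⇒⇔ (outerFun-unique pq (∗-outerDet p q) a)
  ; F-id         = λ p a b → ⇔-trans (≐⇒⇔ (outerFun-unique p 𝟙-outerDet a) b) (mk⇔ lift lower)
  ; F-⋁          = λ ps p a → ≐⇒⇔ (outerFun-unique p (⋒-outerDet ps) a)
  ; F-mono       = λ p q R≤S a b → ≤ₒ⇒outerFun-⊆ p q R≤S a
  ; F-reflect    = λ p q F⊆G → outerFun-⊆⇒≤ₒ p q λ a → F⊆G a _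
  ; F-injective  = λ p q F≈G → ≈ₘ-fromOuterFun p q λ a → ⇔⇒≐ (F≈G a)
  ; F-surjective = λ S _ → graph S , graph-outerDet S , λ a b → ⇔-refl
  }

proposition3p8 : (IsQuantaloid InnerQ × Isomorphic InnerQ (RelQ (lsuc 0ℓ)))
                 × (IsQuantaloid OuterQ × Isomorphic OuterQ (RelQ 0ℓ))
proposition3p8 =
    (isQuantaloid-transport innerClosed inner≅Rel (Rel-isQuantaloid _) , _ , inner≅Rel)
  , (isQuantaloid-transport outerClosed outer≅Rel (Rel-isQuantaloid _) , _ , outer≅Rel)
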